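{- Let $G$ be a $d$-edge-colorable graph and let $\varphi$ be a partial $d$-edge coloring of $G$. Suppose there is a set $K$ of $k$ vertices of $G$ such that every edge colored under $\varphi$ is incident with some vertex of $K$, and every color appears on at most $d-k$ edges under $\varphi$. Then $\varphi$ is avoidable.
   Context: A partial $d$-edge coloring of $G$ assigns colors from $\{1,\dots,d\}$ to some subset of the edges of $G$ (not necessarily properly). It is avoidable if there is a proper $d$-edge coloring $f$ of $G$ with colors $1,\dots,d$ such that $f(e)\neq\varphi(e)$ for every edge $e$ colored under $\varphi$. -}

module Defs where

open import Data.Nat using (ℕ; _≤_; _∸_; _<?_)
open import Data.Fin using (Fin; toℕ)
open import Data.Fin.Properties using () renaming (_≟_ to _≟ᶠ_)
open import Data.Fin.Subset using (Subset; _∈_; ∣_∣)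
open import Data.Bool using (Bool; true; false)
open import Data.Maybe using (Maybe; just; nothing)
open import Data.Maybe.Properties using (≡-dec)
open import Data.Product using (Σ; ∃; _×_; _,_; proj₁; proj₂)
open import Data.Sum using (_⊎_)
open import Data.List using (List; length; filter; cartesianProduct; allFin)
open import Relation.Binary.PropositionalEquality using (_≡_; _≢_)
open import Relation.Nullary using (¬_)
open import Relation.Nullary.Decidable using (_×-dec_)

record Graph : Set where
  field
    n     : ℕ
    adj   : Fin n → Fin n → Bool
    sym   : ∀ u v → adj u v ≡ adj v u
    irrefl : ∀ u → adj u u ≡ false

open Graph public

Adj : (G : Graph) → Fin (n G) → Fin (n G) → Set
Adj G u v = adj G u v ≡ true

-- A (total) d-edge coloring, colors 1..d represented by Fin d.
-- The edge uv gets color c u v; c must be symmetric on edges.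
-- Values on non-adjacent pairs are irrelevant.
record EdgeColoring (G : Graph) (d : ℕ) : Set where
  field
    col    : Fin (n G) → Fin (n G) → Fin d
    colSym : ∀ u v → Adj G u v → col u v ≡ col v u

open EdgeColoring public

Proper : {G : Graph} {d : ℕ} → EdgeColoring G d → Set
Proper {G} f = ∀ u v w → Adj G u v → Adj G u w → v ≢ w → col f u v ≢ col f u w

EdgeColorable : Graph → ℕ → Set
EdgeColorable G d = Σ (EdgeColoring G d) Proper

-- A partial d-edge coloring (not necessarily proper): each edge uv gets
-- either a color (just c) or is uncolored (nothing); symmetric on edges.
record PartialColoring (G : Graph) (d : ℕ) : Set where
  field
    pcol    : Fin (n G) → Fin (n G) → Maybe (Fin d)
    pcolSym : ∀ u v → Adj G u v → pcol u v ≡ pcol v u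

open PartialColoring public

Avoidable : {G : Graph} {d : ℕ} → PartialColoring G d → Set
Avoidable {G} {d} φ =
  Σ (EdgeColoring G d) λ f → Proper f ×
    (∀ u v (c : Fin d) → Adj G u v → pcol φ u v ≡ just c → col f u v ≢ c)

-- number of edges of G (each edge counted once, as the pair u < v)
-- colored c under φ
colorCount : {G : Graph} {d : ℕ} → PartialColoring G d → Fin d → ℕ
colorCount {G} φ c =
  length (filter (λ p → (toℕ (proj₁ p) <? toℕ (proj₂ p))
                   ×-dec (Data.Bool._≟_ (adj G (proj₁ p) (proj₂ p)) true)
                   ×-dec ≡-dec _≟ᶠ_ (pcol φ (proj₁ p) (proj₂ p)) (just c))
                 (cartesianProduct (allFin (n G)) (allFin (n G))))

-- Fix a proper colouring f and call the pair (i, c) of colours forbidden when some edge of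
-- f-colour i has φ-colour c.  Since every colour class of f is a matching and every
-- φ-coloured edge meets K, each f-colour is forbidden together with at most k φ-colours;
-- since each φ-colour is used at most d - k times, it is forbidden together with at most
-- d - k f-colours.  A d × d 0/1 matrix with row sums ≤ k and column sums ≤ d - k has a
-- zero transversal π: while some row r hits a 1 at π r, a counting argument gives a row y
-- such that exchanging π r and π y clears both rows, which strictly shrinks the set of
-- conflicting rows.  Renaming the colours of f by π then avoids φ.

module Submission where

open import Defs hiding (sym)
open import Data.Nat using (ℕ; _≤_; _<_; _∸_; _<?_; z≤n)
open import Data.Fin using (Fin; toℕ)
open import Data.Fin.Subset using (Subset; _∈_; ∣_∣)
open import Data.Maybe using (just)
open import Data.Sum using (_⊎_; inj₁; inj₂)
open import Relation.Binary.PropositionalEquality using (_≡_; _≢_; refl; sym; trans; cong; subst)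

open import Data.Nat.Properties using (∸-monoʳ-≤; ≤-trans; <⇒≱; <-cmp; module ≤-Reasoning)
open import Data.Fin.Properties using (any?; suc-injective; 0≢1+n; toℕ-injective) renaming (_≟_ to _≟ᶠ_)
open import Data.Fin.Subset using (_⊂_; _-_; ∁; outside; inside)
open import Data.Fin.Subset.Properties
  using (x∈p∧x≢y⇒x∈p-y; x∈p⇒∣p-x∣<∣p∣; p⊂q⇒∣p∣<∣q∣; ∣∁p∣≡n∸∣p∣; x∈∁p⇒x∉p; nonempty?; ∈⊤; ∣⊤∣≡n)
open import Data.Fin.Subset.Induction using (Acc; acc; ⊂-wellFounded)
open import Data.Fin.Permutation using (Permutation′; id; _⟨$⟩ʳ_; transpose; _∘ₚ_)
import Data.Fin.Permutation.Components as Components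
open import Data.Bool using (Bool; T; true) renaming (_≟_ to _≟ᵇ_)
open import Data.Bool.Properties using (T-≡)
open import Data.Maybe.Properties using (≡-dec; just-injective)
open import Data.Vec using ([]; _∷_; tabulate; here; there)
open import Data.Vec.Properties using (lookup∘tabulate; []=⇒lookup; lookup⇒[]=)
open import Data.List using (List; length; lookup; filter; cartesianProduct; allFin)
import Data.List.Relation.Unary.Any as Any
open import Data.List.Relation.Unary.Any.Properties using (lookup-index)
open import Data.List.Membership.Propositional using () renaming (_∈_ to _∈ˡ_)
open import Data.List.Membership.Propositional.Properties using (∈-filter⁺; ∈-cartesianProduct⁺; ∈-allFin)
open import Data.Product using (∃; _×_; _,_; proj₁; proj₂; uncurry)
open import Function using (_∘_; Equivalence; Injection)
open import Function.Properties.Inverse using (Inverse⇒Injection)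
open import Relation.Nullary using (¬_; Dec; yes; no; contradiction)
open import Relation.Nullary.Decidable using (_×-dec_; ¬?; T?; decidable-stable; isYes; map′; toWitness; fromWitness)
open import Relation.Binary.Definitions using (tri<; tri≈; tri>)

injective⇒∣p∣≤∣q∣ : ∀ {a b} {p : Subset a} {q : Subset b}
  (h : ∀ {x} → x ∈ p → Fin b) → (∀ {x} (x∈p : x ∈ p) → h x∈p ∈ q) →
  (∀ {x y} (x∈p : x ∈ p) (y∈p : y ∈ p) → h x∈p ≡ h y∈p → x ≡ y) →
  ∣ p ∣ ≤ ∣ q ∣
injective⇒∣p∣≤∣q∣ {p = []} _ _ _ = z≤n
injective⇒∣p∣≤∣q∣ {p = outside ∷ p} h h∈q h-inj =
  injective⇒∣p∣≤∣q∣ (λ x∈p → h (there x∈p)) (λ x∈p → h∈q (there x∈p))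
    (λ x∈p y∈p eq → suc-injective (h-inj (there x∈p) (there y∈p) eq))
injective⇒∣p∣≤∣q∣ {p = inside ∷ p} {q} h h∈q h-inj = begin-strict
  ∣ p ∣             ≤⟨ injective⇒∣p∣≤∣q∣ (λ x∈p → h (there x∈p)) h∈q-h₀
                         (λ x∈p y∈p eq → suc-injective (h-inj (there x∈p) (there y∈p) eq)) ⟩
  ∣ q - h here ∣    <⟨ x∈p⇒∣p-x∣<∣p∣ (h∈q here) ⟩
  ∣ q ∣             ∎
  where
  open ≤-Reasoning
  h∈q-h₀ : ∀ {x} (x∈p : x ∈ p) → h (there x∈p) ∈ q - h here
  h∈q-h₀ x∈p = x∈p∧x≢y⇒x∈p-y (h∈q (there x∈p)) (λ eq → 0≢1+n (h-inj here (there x∈p) (sym eq)))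

∣p∣≤length : ∀ {A : Set} {a} {p : Subset a} (xs : List A) (h : ∀ {x} → x ∈ p → A) →
  (∀ {x} (x∈p : x ∈ p) → h x∈p ∈ˡ xs) →
  (∀ {x y} (x∈p : x ∈ p) (y∈p : y ∈ p) → h x∈p ≡ h y∈p → x ≡ y) →
  ∣ p ∣ ≤ length xs
∣p∣≤length xs h h∈xs h-inj = subst (_ ≤_) (∣⊤∣≡n (length xs))
  (injective⇒∣p∣≤∣q∣ (λ x∈p → Any.index (h∈xs x∈p)) (λ _ → ∈⊤) λ x∈p y∈p eq →
    h-inj x∈p y∈p (trans (lookup-index (h∈xs x∈p)) (trans (cong (lookup xs) eq) (sym (lookup-index (h∈xs y∈p))))))

∈-tabulate⁺ : ∀ {n} {P : Fin n → Bool} {x} → T (P x) → x ∈ tabulate P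
∈-tabulate⁺ {P = P} {x} t = lookup⇒[]= x (tabulate P) (trans (lookup∘tabulate P x) (Equivalence.to T-≡ t))

∈-tabulate⁻ : ∀ {n} {P : Fin n → Bool} {x} → x ∈ tabulate P → T (P x)
∈-tabulate⁻ {P = P} {x} x∈ = Equivalence.from T-≡ (trans (sym (lookup∘tabulate P x)) ([]=⇒lookup x∈))

transpose-cases : ∀ {n} (r y i : Fin n) →
  (i ≡ r × Components.transpose r y i ≡ y) ⊎
  (i ≡ y × Components.transpose r y i ≡ r) ⊎
  (i ≢ r × Components.transpose r y i ≡ i)
transpose-cases r y i with i ≟ᶠ r
... | yes i≡r = inj₁ (i≡r , refl)
... | no i≢r with i ≟ᶠ y
...   | yes i≡y = inj₂ (inj₁ (i≡y , refl))
...   | no _    = inj₂ (inj₂ (i≢r , refl))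

module _ {d : ℕ} (B : Fin d → Fin d → Bool) where

  row : Fin d → Subset d
  row i = tabulate (B i)

  column : Fin d → Subset d
  column c = tabulate (λ i → B i c)

  permutedRow : Permutation′ d → Fin d → Subset d
  permutedRow π i = tabulate (λ y → B i (π ⟨$⟩ʳ y))

  conflicts : Permutation′ d → Subset d
  conflicts π = tabulate (λ i → B i (π ⟨$⟩ʳ i))

  ∣permutedRow∣≤∣row∣ : ∀ π i → ∣ permutedRow π i ∣ ≤ ∣ row i ∣
  ∣permutedRow∣≤∣row∣ π i =
    injective⇒∣p∣≤∣q∣ (λ {y} _ → π ⟨$⟩ʳ y) (λ y∈ → ∈-tabulate⁺ (∈-tabulate⁻ y∈))
      (λ _ _ → Injection.injective (Inverse⇒Injection π))

  -- (transpose r y ∘ₚ π) ⟨$⟩ʳ i is π ⟨$⟩ʳ Components.transpose r y i: rows r and y exchange their columns.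
  swapping-reduces-conflicts : ∀ π r y → T (B r (π ⟨$⟩ʳ r)) →
    ¬ T (B r (π ⟨$⟩ʳ y)) → ¬ T (B y (π ⟨$⟩ʳ r)) →
    conflicts (transpose r y ∘ₚ π) ⊂ conflicts π
  swapping-reduces-conflicts π r y conflict-r free-ry free-yr =
    fewer , r , ∈-tabulate⁺ conflict-r , λ r∈ → resolved (∈-tabulate⁻ r∈)
    where
    fewer : ∀ {i} → i ∈ conflicts (transpose r y ∘ₚ π) → i ∈ conflicts π
    fewer {i} i∈ with transpose-cases r y i | ∈-tabulate⁻ i∈
    ... | inj₁ (refl , τi≡y)        | t = contradiction (subst (λ j → T (B i (π ⟨$⟩ʳ j))) τi≡y t) free-ry
    ... | inj₂ (inj₁ (refl , τi≡r)) | t = contradiction (subst (λ j → T (B i (π ⟨$⟩ʳ j))) τi≡r t) free-yr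
    ... | inj₂ (inj₂ (_ , τi≡i))    | t = ∈-tabulate⁺ (subst (λ j → T (B i (π ⟨$⟩ʳ j))) τi≡i t)
    resolved : ¬ T (B r (π ⟨$⟩ʳ Components.transpose r y r))
    resolved with transpose-cases r y r
    ... | inj₁ (_ , τr≡y)           = subst (λ j → ¬ T (B r (π ⟨$⟩ʳ j))) (sym τr≡y) free-ry
    ... | inj₂ (inj₁ (refl , τr≡r)) = subst (λ j → ¬ T (B r (π ⟨$⟩ʳ j))) (sym τr≡r) free-yr
    ... | inj₂ (inj₂ (r≢r , _))     = contradiction refl r≢r

module _ {d k : ℕ} (B : Fin d → Fin d → Bool)
         (row-sparse : ∀ i → ∣ row B i ∣ ≤ k) (column-sparse : ∀ c → ∣ column B c ∣ ≤ d ∸ k) where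

  -- Without a partner, the ≥ d ∸ k free positions of row r would form a proper subset of column π r.
  swap-partner : ∀ π r → T (B r (π ⟨$⟩ʳ r)) →
    ∃ λ y → ¬ T (B r (π ⟨$⟩ʳ y)) × ¬ T (B y (π ⟨$⟩ʳ r))
  swap-partner π r conflict-r with any? (λ y → ¬? (T? (B r (π ⟨$⟩ʳ y))) ×-dec ¬? (T? (B y (π ⟨$⟩ʳ r))))
  ... | yes partner = partner
  ... | no none = contradiction many-free (<⇒≱ (p⊂q⇒∣p∣<∣q∣ free⊂column))
    where
    open ≤-Reasoning
    free : Subset d
    free = ∁ (permutedRow B π r)
    free⊂column : free ⊂ column B (π ⟨$⟩ʳ r)
    free⊂column = (λ {y} y∈ → ∈-tabulate⁺ (decidable-stable (T? _) λ free-yr →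
                     none (y , x∈∁p⇒x∉p y∈ ∘ ∈-tabulate⁺ , free-yr)))
                , r , ∈-tabulate⁺ conflict-r , λ r∈ → x∈∁p⇒x∉p r∈ (∈-tabulate⁺ conflict-r)
    many-free : ∣ column B (π ⟨$⟩ʳ r) ∣ ≤ ∣ free ∣
    many-free = begin
      ∣ column B (π ⟨$⟩ʳ r) ∣          ≤⟨ column-sparse (π ⟨$⟩ʳ r) ⟩
      d ∸ k                            ≤⟨ ∸-monoʳ-≤ d (≤-trans (∣permutedRow∣≤∣row∣ B π r) (row-sparse r)) ⟩
      d ∸ ∣ permutedRow B π r ∣        ≡⟨ sym (∣∁p∣≡n∸∣p∣ (permutedRow B π r)) ⟩
      ∣ free ∣                         ∎

  conflict-free-from : ∀ π → Acc _⊂_ (conflicts B π) → ∃ λ σ → ∀ i → ¬ T (B i (σ ⟨$⟩ʳ i))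
  conflict-free-from π (acc smaller) with nonempty? (conflicts B π)
  ... | no none = π , λ i t → none (i , ∈-tabulate⁺ t)
  ... | yes (r , r∈) with swap-partner π r (∈-tabulate⁻ r∈)
  ...   | y , free-ry , free-yr = conflict-free-from (transpose r y ∘ₚ π)
            (smaller (swapping-reduces-conflicts B π r y (∈-tabulate⁻ r∈) free-ry free-yr))

  conflict-free-permutation : ∃ λ σ → ∀ i → ¬ T (B i (σ ⟨$⟩ʳ i))
  conflict-free-permutation = conflict-free-from id (⊂-wellFounded (conflicts B id))

permuteColors : ∀ {G d} → Permutation′ d → EdgeColoring G d → EdgeColoring G d
permuteColors π f = record
  { col    = λ u v → π ⟨$⟩ʳ col f u v
  ; colSym = λ u v uv → cong (π ⟨$⟩ʳ_) (colSym f u v uv)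
  }

permuteColors-proper : ∀ {G d} (π : Permutation′ d) (f : EdgeColoring G d) → Proper f → Proper (permuteColors π f)
permuteColors-proper π f f-proper u v w uv uw v≢w =
  f-proper u v w uv uw v≢w ∘ Injection.injective (Inverse⇒Injection π)

module _ {G : Graph} {d : ℕ} (f : EdgeColoring G d) (φ : PartialColoring G d) where

  private
    V : Set
    V = Fin (n G)

  record ColoredEdge (i c : Fin d) : Set where
    constructor edge
    field
      source target : V
      adjacent      : Adj G source target
      f-colored     : col f source target ≡ i
      φ-colored     : pcol φ source target ≡ just c

  open ColoredEdge

  reverse : ∀ {i c} → ColoredEdge i c → ColoredEdge i c
  reverse (edge u v uv fi φc) =
    edge v u (trans (Graph.sym G v u) uv) (trans (sym (colSym f u v uv)) fi) (trans (sym (pcolSym φ u v uv)) φc)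

  orient : ∀ {i c} (P : V → V → Set) (e : ColoredEdge i c) →
    P (source e) (target e) ⊎ P (target e) (source e) → ∃ λ e′ → P (source e′) (target e′)
  orient P e (inj₁ p) = e , p
  orient P e (inj₂ p) = reverse e , p

  coloredEdge? : ∀ i c → Dec (ColoredEdge i c)
  coloredEdge? i c = map′ (λ (u , v , uv , fi , φc) → edge u v uv fi φc)
                          (λ (edge u v uv fi φc) → u , v , uv , fi , φc)
    (any? λ u → any? λ v → (adj G u v ≟ᵇ true) ×-dec (col f u v ≟ᶠ i) ×-dec ≡-dec _≟ᶠ_ (pcol φ u v) (just c))

  forbidden : Fin d → Fin d → Bool
  forbidden i c = isYes (coloredEdge? i c)

  coloredPair? : ∀ c (p : V × V) →
    Dec (toℕ (proj₁ p) < toℕ (proj₂ p) × Adj G (proj₁ p) (proj₂ p) × pcol φ (proj₁ p) (proj₂ p) ≡ just c)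
  coloredPair? c p = (toℕ (proj₁ p) <? toℕ (proj₂ p))
                   ×-dec (adj G (proj₁ p) (proj₂ p) ≟ᵇ true)
                   ×-dec ≡-dec _≟ᶠ_ (pcol φ (proj₁ p) (proj₂ p)) (just c)

  coloredPairs : Fin d → List (V × V)
  coloredPairs c = filter (coloredPair? c) (cartesianProduct (allFin (n G)) (allFin (n G)))

  same-source⇒same-φ-color : Proper f → ∀ {i c c′} (e : ColoredEdge i c) (e′ : ColoredEdge i c′) →
    source e ≡ source e′ → c ≡ c′
  same-source⇒same-φ-color f-proper (edge u v uv fi φc) (edge .u v′ uv′ fi′ φc′) refl with v ≟ᶠ v′
  ... | yes refl = just-injective (trans (sym φc) φc′)
  ... | no v≢v′  = contradiction (trans fi (sym fi′)) (f-proper u v v′ uv uv′ v≢v′)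

  forbidden-row-sparse : Proper f → (K : Subset (n G)) →
    (∀ u v c → Adj G u v → pcol φ u v ≡ just c → u ∈ K ⊎ v ∈ K) →
    ∀ i → ∣ row forbidden i ∣ ≤ ∣ K ∣
  forbidden-row-sparse f-proper K K-covers i =
    injective⇒∣p∣≤∣q∣ (source ∘ proj₁ ∘ anchored) (proj₂ ∘ anchored)
      λ c∈ c′∈ → same-source⇒same-φ-color f-proper (proj₁ (anchored c∈)) (proj₁ (anchored c′∈))
    where
    anchored : ∀ {c} → c ∈ row forbidden i → ∃ λ (e : ColoredEdge i c) → source e ∈ K
    anchored c∈ with toWitness (∈-tabulate⁻ c∈)
    ... | e@(edge u v uv _ φc) = orient (λ w _ → w ∈ K) e (K-covers u v _ uv φc)

  -- colorCount φ c unfolds to length (coloredPairs c).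
  forbidden-column-sparse : ∀ c → ∣ column forbidden c ∣ ≤ colorCount φ c
  forbidden-column-sparse c = ∣p∣≤length (coloredPairs c) (endpoints ∘ proj₁ ∘ ascending)
    (λ i∈ → uncurry listed (ascending i∈))
    (λ i∈ i′∈ same → trans (sym (f-colored (proj₁ (ascending i∈))))
                       (trans (cong (uncurry (col f)) same) (f-colored (proj₁ (ascending i′∈)))))
    where
    endpoints : ∀ {i} → ColoredEdge i c → V × V
    endpoints e = source e , target e
    listed : ∀ {i} (e : ColoredEdge i c) → toℕ (source e) < toℕ (target e) → endpoints e ∈ˡ coloredPairs c
    listed (edge u v uv _ φc) u<v = ∈-filter⁺ (coloredPair? c) (∈-cartesianProduct⁺ (∈-allFin u) (∈-allFin v)) (u<v , uv , φc)
    ascending : ∀ {i} → i ∈ column forbidden c → ∃ λ (e : ColoredEdge i c) → toℕ (source e) < toℕ (target e)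
    ascending i∈ with toWitness (∈-tabulate⁻ i∈)
    ... | e@(edge u v uv _ _) with <-cmp (toℕ u) (toℕ v)
    ...   | tri< u<v _ _ = e , u<v
    ...   | tri> _ _ v<u = reverse e , v<u
    ...   | tri≈ _ u≡v _ with toℕ-injective u≡v
    ...     | refl = contradiction (trans (sym uv) (irrefl G u)) λ ()

  conflict-free⇒avoidable : Proper f → (∃ λ π → ∀ i → ¬ T (forbidden i (π ⟨$⟩ʳ i))) → Avoidable φ
  conflict-free⇒avoidable f-proper (π , conflict-free) =
    permuteColors π f , permuteColors-proper π f f-proper ,
    λ { u v _ uv φc refl → conflict-free (col f u v) (fromWitness (edge u v uv refl φc)) }

proposition3p4 : (G : Graph) (d k : ℕ) → EdgeColorable G d →
    (φ : PartialColoring G d) → (K : Subset (n G)) → ∣ K ∣ ≡ k →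
    (∀ u v (c : Fin d) → Adj G u v → pcol φ u v ≡ just c → (u ∈ K ⊎ v ∈ K)) →
    (∀ (c : Fin d) → colorCount φ c ≤ d ∸ k) →
    Avoidable φ
proposition3p4 G d k (f , f-proper) φ K ∣K∣≡k K-covers color-rare =
  conflict-free⇒avoidable f φ f-proper (conflict-free-permutation (forbidden f φ) row-sparse column-sparse)
  where
  row-sparse : ∀ i → ∣ row (forbidden f φ) i ∣ ≤ k
  row-sparse i = subst (_ ≤_) ∣K∣≡k (forbidden-row-sparse f φ f-proper K K-covers i)

  column-sparse : ∀ c → ∣ column (forbidden f φ) c ∣ ≤ d ∸ k
  column-sparse c = ≤-trans (forbidden-column-sparse f φ c) (color-rare c)
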